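{- Let $k\ge 2$ and let $\mathcal{H}=(V,\mathcal{E})$ be a $k$-uniform 2-hypertree. Then any two distinct maximal stars of $\mathcal{H}$ are edge-disjoint.
   Context: A $k$-uniform hypergraph $\mathcal{H}=(V,\mathcal{E})$ consists of a finite vertex set $V$ and a set $\mathcal{E}$ of $k$-element subsets of $V$ (no multiple edges). A $k$-uniform hypergraph is a chain if there is a sequence $v_1,\dots,v_l$ of its vertices in which every vertex appears at least once (possibly more times), $v_1\ne v_l$, and its edge set consists of exactly the $l-k+1$ distinct sets $\{v_i,\dots,v_{i+k-1}\}$, $1\le i\le l-k+1$; it is a semicycle if the same holds with $v_1=v_l$ instead. Length = number of edges. $\mathcal{H}$ is chain-connected if every pair of distinct vertices is contained in some subhypergraph that is a chain; semicycle-free if no subhypergraph is a semicycle. A hypertree is a chain-connected, semicycle-free $k$-uniform hypergraph; a 2-hypertree is a hypertree in which every chain (subhypergraph) has length at most 2. A star of $\mathcal{H}$ is a nonempty set $S\subseteq\mathcal{E}$ of edges all containing a common $(k-1)$-set (i.e. $|\bigcap S|\ge k-1$); a maximal star is a star not properly contained in another star of $\mathcal{H}$. -}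

module Defs where

open import Level using (0ℓ)
open import Data.Nat using (ℕ; _+_; _∸_; _≤_; _<_)
open import Data.Fin using (Fin)
open import Data.Empty using (⊥)
open import Data.Fin.Subset using (Subset; ⁅_⁆; ⋃; ∣_∣) renaming (_⊆_ to _⊆ₛ_; _∈_ to _∈ₛ_)
open import Data.List using (map; upTo)
open import Data.Product using (Σ; ∃; _×_; _,_)
open import Relation.Binary.PropositionalEquality using (_≡_; _≢_)
open import Relation.Unary using (Pred; Satisfiable) renaming (_⊆_ to _⊆ₚ_)

-- A hypergraph on vertex set Fin n is given by its edge set, a predicate on
-- subsets of Fin n (a set of subsets, so no multiple edges).
EdgeSet : ℕ → Set₁
EdgeSet n = Pred (Subset n) 0ℓ

Uniform : {n : ℕ} → ℕ → EdgeSet n → Set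
Uniform k E = ∀ e → E e → ∣ e ∣ ≡ k

-- A sequence v₁,…,v_l of vertices is given by its length l and a map
-- v : ℕ → Fin n of which only v 0, …, v (l ∸ 1) are used.
-- window k v i = { v i , … , v (i + k ∸ 1) }.
window : {n : ℕ} → ℕ → (ℕ → Fin n) → ℕ → Subset n
window k v i = ⋃ (map (λ j → ⁅ v (i + j) ⁆) (upTo k))

-- The sequence (l , v) determines a k-uniform subhypergraph of E whose edges
-- are exactly the l-k+1 distinct k-sets window k v i (i + k ≤ l).
IsWindowSeq : {n : ℕ} → ℕ → EdgeSet n → (l : ℕ) → (ℕ → Fin n) → Set
IsWindowSeq k E l v =
  (k ≤ l)
  × (∀ i → i + k ≤ l → ∣ window k v i ∣ ≡ k)
  × (∀ i j → i + k ≤ l → j + k ≤ l → i ≢ j → window k v i ≢ window k v j)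
  × (∀ i → i + k ≤ l → E (window k v i))

IsChainIn : {n : ℕ} → ℕ → EdgeSet n → (l : ℕ) → (ℕ → Fin n) → Set
IsChainIn k E l v = IsWindowSeq k E l v × (v 0 ≢ v (l ∸ 1))

IsSemicycleIn : {n : ℕ} → ℕ → EdgeSet n → (l : ℕ) → (ℕ → Fin n) → Set
IsSemicycleIn k E l v = IsWindowSeq k E l v × (v 0 ≡ v (l ∸ 1))

-- Number of edges of the chain/semicycle described by (l , v).
seqLength : ℕ → ℕ → ℕ
seqLength k l = l ∸ k + 1

ChainConnected : {n : ℕ} → ℕ → EdgeSet n → Set
ChainConnected {n} k E = ∀ (x y : Fin n) → x ≢ y →
  Σ ℕ λ l → Σ (ℕ → Fin n) λ v → IsChainIn k E l v
    × (Σ ℕ λ i → i < l × v i ≡ x) × (Σ ℕ λ j → j < l × v j ≡ y)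

SemicycleFree : {n : ℕ} → ℕ → EdgeSet n → Set
SemicycleFree {n} k E = ∀ (l : ℕ) (v : ℕ → Fin n) → IsSemicycleIn k E l v → ⊥

Hypertree : {n : ℕ} → ℕ → EdgeSet n → Set
Hypertree k E = ChainConnected k E × SemicycleFree k E

TwoHypertree : {n : ℕ} → ℕ → EdgeSet n → Set
TwoHypertree {n} k E = Hypertree k E
  × (∀ (l : ℕ) (v : ℕ → Fin n) → IsChainIn k E l v → seqLength k l ≤ 2)

Star : {n : ℕ} → ℕ → EdgeSet n → Pred (Subset n) 0ℓ → Set
Star {n} k E S = (S ⊆ₚ E) × Satisfiable S
  × (Σ (Subset n) λ C → (∣ C ∣ ≡ k ∸ 1) × (∀ e → S e → C ⊆ₛ e))

MaximalStar : {n : ℕ} → ℕ → EdgeSet n → Pred (Subset n) 0ℓ → Set₁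
MaximalStar k E S = Star k E S × (∀ T → Star k E T → S ⊆ₚ T → T ⊆ₚ S)

module Submission where

-- Suppose the maximal stars S ≠ T, with centres C_S and C_T (sets of size
-- k - 1), both contain the edge e.  A maximal star contains every edge
-- through its centre, so C_S ≠ C_T; and a maximal star cannot consist of e
-- alone (it would then be contained in the other star).  Hence S has an edge
-- f ≠ e and T an edge g ≠ e.  Two k-sets sharing a (k-1)-set differ by one
-- exchange: C_S = e - b, f = e - b + x and C_T = e - a, g = e - a + y with
-- a, b ∈ e, x, y ∉ e, and a ≠ b because the centres differ.  Listing the
-- vertices as  x, a, (e - a - b), b, y  gives a sequence whose three windows
-- are f, e, g: a window sequence with three edges, i.e. a semicycle (x = y)
-- or a chain of length 3 — impossible in a 2-hypertree.

open import Defs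
open import Data.Nat using (ℕ; zero; suc; _+_; _∸_; _≤_; _<_; z≤n; s≤s)
open import Data.Nat.Properties
  using (≤-trans; ≤-refl; <-irrefl; 1+n≰n; m≤n+m; suc-injective; m+n∸n≡m; +-identityʳ; +-comm; m<1+n⇒m<n∨m≡n; m<n⇒m<1+n)
import Data.Bool as Bool
open import Data.Fin using (Fin; zero; suc)
import Data.Fin.Properties as Fin
open import Data.Fin.Subset
  using (Subset; inside; outside; _∈_; _∉_; _⊆_; _─_; _-_; _∪_; _∩_; ∁; ⁅_⁆; ⋃; ∣_∣)
open import Data.Fin.Subset.Properties
open import Data.List using (List; []; _∷_; map; length; upTo)
open import Data.List.Properties using (length-map)
open import Data.List.Membership.Propositional using () renaming (_∈_ to _∈ₗ_)
open import Data.List.Membership.Propositional.Properties using (∈-map⁺; ∈-map⁻; ∈-upTo⁺; ∈-upTo⁻)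
open import Data.List.Relation.Unary.Any using (here; there)
open import Data.Vec using ([]; _∷_; here; there)
open import Data.Vec.Properties using (≡-dec)
open import Data.Product using (Σ; ∃; _×_; _,_; proj₁; proj₂)
open import Data.Sum using (_⊎_; inj₁; inj₂)
open import Data.Empty using (⊥; ⊥-elim)
open import Function using (_∘_)
open import Relation.Nullary using (¬_; Dec; yes; no)
open import Relation.Nullary.Decidable using (decidable-stable)
open import Relation.Unary using (_≐_) renaming (_⊆_ to _⊆ₚ_)
open import Relation.Unary.Properties using (≐-sym)
open import Relation.Binary.PropositionalEquality

private
  variable
    n : ℕ

_≟ₛ_ : (p q : Subset n) → Dec (p ≡ q)
_≟ₛ_ = ≡-dec Bool._≟_

x∈p─q⇒x∉q : {x : Fin n} (p q : Subset n) → x ∈ p ─ q → x ∉ q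
x∈p─q⇒x∉q (_ ∷ p) (outside ∷ q) here          ()
x∈p─q⇒x∉q (_ ∷ p) (_ ∷ q)       (there x∈p─q) (there x∈q) = x∈p─q⇒x∉q p q x∈p─q x∈q

x∈p-y⁻ : {x y : Fin n} (p : Subset n) → x ∈ p - y → x ∈ p × x ≢ y
x∈p-y⁻ {y = y} p x∈p-y = p─q⊆p p ⁅ y ⁆ x∈p-y , x∉⁅y⁆⇒x≢y (x∈p─q⇒x∉q p ⁅ y ⁆ x∈p-y)

∣p-x∣+1≡∣p∣ : {x : Fin n} (p : Subset n) → x ∈ p → suc ∣ p - x ∣ ≡ ∣ p ∣
∣p-x∣+1≡∣p∣ {x = zero}  (inside ∷ p)  here        = cong (suc ∘ ∣_∣) (p─⊥≡p p)
∣p-x∣+1≡∣p∣ {x = suc x} (inside ∷ p)  (there x∈p) = cong suc (∣p-x∣+1≡∣p∣ p x∈p)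
∣p-x∣+1≡∣p∣ {x = suc x} (outside ∷ p) (there x∈p) = ∣p-x∣+1≡∣p∣ p x∈p

∣p∪⁅x⁆∣≡∣p∣+1 : {x : Fin n} (p : Subset n) → x ∉ p → ∣ p ∪ ⁅ x ⁆ ∣ ≡ suc ∣ p ∣
∣p∪⁅x⁆∣≡∣p∣+1 {x = zero}  (inside ∷ p)  x∉p = ⊥-elim (x∉p here)
∣p∪⁅x⁆∣≡∣p∣+1 {x = zero}  (outside ∷ p) x∉p = cong (suc ∘ ∣_∣) (∪-identityʳ p)
∣p∪⁅x⁆∣≡∣p∣+1 {x = suc x} (inside ∷ p)  x∉p = cong suc (∣p∪⁅x⁆∣≡∣p∣+1 p (x∉p ∘ there))
∣p∪⁅x⁆∣≡∣p∣+1 {x = suc x} (outside ∷ p) x∉p = ∣p∪⁅x⁆∣≡∣p∣+1 p (x∉p ∘ there)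

⊆-or-witness : (p q : Subset n) → p ⊆ q ⊎ ∃ λ z → z ∈ p × z ∉ q
⊆-or-witness p q with nonempty? (p ∩ ∁ q)
... | yes (z , z∈p∩∁q) = let z∈p , z∈∁q = x∈p∩q⁻ p (∁ q) z∈p∩∁q in inj₂ (z , z∈p , x∈∁p⇒x∉p z∈∁q)
... | no  p∩∁q-empty  = inj₁ p⊆q
  where
  p⊆q : p ⊆ q
  p⊆q {z} z∈p with z ∈? q
  ... | yes z∈q = z∈q
  ... | no  z∉q = ⊥-elim (p∩∁q-empty (z , x∈p∩q⁺ (z∈p , x∉p⇒x∈∁p z∉q)))

⊆∧∣∣≡⇒≡ : {p q : Subset n} → p ⊆ q → ∣ p ∣ ≡ ∣ q ∣ → p ≡ q
⊆∧∣∣≡⇒≡ {p = p} {q} p⊆q ∣p∣≡∣q∣ with ⊆-or-witness q p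
... | inj₁ q⊆p              = ⊆-antisym p⊆q q⊆p
... | inj₂ (z , z∈q , z∉p) = ⊥-elim (<-irrefl ∣p∣≡∣q∣ (p⊂q⇒∣p∣<∣q∣ (p⊆q , z , z∈q , z∉p)))

-- Every subset can be listed: a list of exactly ∣ p ∣ entries, with the same
-- members as p.  Used to spell out a (k-2)-set inside a vertex sequence.
Listing : Subset n → Set
Listing {n} p = Σ (List (Fin n)) λ L →
  length L ≡ ∣ p ∣ × (∀ {z} → z ∈ p → z ∈ₗ L) × (∀ {z} → z ∈ₗ L → z ∈ p)

∈-map-suc⁻ : ∀ {s} {p : Subset n} {L} → (∀ {w} → w ∈ₗ L → w ∈ p) → ∀ {z} → z ∈ₗ map suc L → z ∈ s ∷ p
∈-map-suc⁻ sound z∈sucL with ∈-map⁻ suc z∈sucL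
... | _ , w∈L , refl = there (sound w∈L)

listing : (p : Subset n) → Listing p
listing []            = [] , refl , (λ ()) , (λ ())
listing (inside ∷ p)  with listing p
... | L , ∣L∣≡∣p∣ , complete , sound =
  zero ∷ map suc L , cong suc (trans (length-map suc L) ∣L∣≡∣p∣) ,
  (λ { here → here refl ; (there z∈p) → there (∈-map⁺ suc (complete z∈p)) }) ,
  (λ { (here refl) → here ; (there z∈sucL) → ∈-map-suc⁻ sound z∈sucL })
listing (outside ∷ p) with listing p
... | L , ∣L∣≡∣p∣ , complete , sound =
  map suc L , trans (length-map suc L) ∣L∣≡∣p∣ ,
  (λ { (there z∈p) → ∈-map⁺ suc (complete z∈p) }) ,
  ∈-map-suc⁻ sound

∈-⋃⁻ : {z : Fin n} (ps : List (Subset n)) → z ∈ ⋃ ps → ∃ λ q → q ∈ₗ ps × z ∈ q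
∈-⋃⁻ []       z∈⊥ = ⊥-elim (∉⊥ z∈⊥)
∈-⋃⁻ (p ∷ ps) z∈⋃ with x∈p∪q⁻ p (⋃ ps) z∈⋃
... | inj₁ z∈p  = p , here refl , z∈p
... | inj₂ z∈ps with ∈-⋃⁻ ps z∈ps
...   | q , q∈ps , z∈q = q , there q∈ps , z∈q

∈-⋃⁺ : {z : Fin n} {q : Subset n} (ps : List (Subset n)) → q ∈ₗ ps → z ∈ q → z ∈ ⋃ ps
∈-⋃⁺ (p ∷ ps) (here refl) z∈q = x∈p∪q⁺ (inj₁ z∈q)
∈-⋃⁺ (p ∷ ps) (there q∈ps) z∈q = x∈p∪q⁺ (inj₂ (∈-⋃⁺ ps q∈ps z∈q))

∈-window⁻ : ∀ k (v : ℕ → Fin n) i {z} → z ∈ window k v i → ∃ λ j → j < k × v (i + j) ≡ z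
∈-window⁻ k v i z∈w with ∈-⋃⁻ (map (λ j → ⁅ v (i + j) ⁆) (upTo k)) z∈w
... | q , q∈singletons , z∈q with ∈-map⁻ (λ j → ⁅ v (i + j) ⁆) q∈singletons
...   | j , j∈upTo , refl = j , ∈-upTo⁻ j∈upTo , sym (x∈⁅y⁆⇒x≡y _ z∈q)

∈-window⁺ : ∀ k (v : ℕ → Fin n) i {j} → j < k → v (i + j) ∈ window k v i
∈-window⁺ k v i {j} j<k =
  ∈-⋃⁺ (map (λ j → ⁅ v (i + j) ⁆) (upTo k)) (∈-map⁺ (λ j → ⁅ v (i + j) ⁆) (∈-upTo⁺ j<k)) (x∈⁅x⁆ _)

window≡ : ∀ k (v : ℕ → Fin n) i {s : Subset n}
  → (∀ j → j < k → v (i + j) ∈ s) → (∀ {z} → z ∈ s → ∃ λ j → j < k × v (i + j) ≡ z)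
  → window k v i ≡ s
window≡ k v i sound complete = ⊆-antisym window⊆s s⊆window
  where
  window⊆s : window k v i ⊆ _
  window⊆s z∈w with ∈-window⁻ k v i z∈w
  ... | j , j<k , refl = sound j j<k
  s⊆window : _ ⊆ window k v i
  s⊆window z∈s with complete z∈s
  ... | j , j<k , refl = ∈-window⁺ k v i j<k

prepend : {A : Set} → List A → (ℕ → A) → ℕ → A
prepend []       w = w
prepend (d ∷ ds) w zero    = d
prepend (d ∷ ds) w (suc j) = prepend ds w j

module _ {A : Set} (w : ℕ → A) where

  prepend-∈ : ∀ L {j} → j < length L → prepend L w j ∈ₗ L
  prepend-∈ (d ∷ L) {zero}  _         = here refl
  prepend-∈ (d ∷ L) {suc j} (s≤s j<L) = there (prepend-∈ L j<L)

  prepend-index : ∀ L {z} → z ∈ₗ L → ∃ λ j → j < length L × prepend L w j ≡ z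
  prepend-index (d ∷ L) (here refl) = zero , s≤s z≤n , refl
  prepend-index (d ∷ L) (there z∈L) with prepend-index L z∈L
  ... | j , j<L , eq = suc j , s≤s j<L , eq

  prepend-after : ∀ L j → prepend L w (length L + j) ≡ w j
  prepend-after []      j = refl
  prepend-after (d ∷ L) j = prepend-after L j

replace : Subset n → Fin n → Fin n → Subset n
replace e b x = (e - b) ∪ ⁅ x ⁆

module _ {e : Subset n} {b x : Fin n} where

  x∈replace : x ∈ replace e b x
  x∈replace = x∈p∪q⁺ (inj₂ (x∈⁅x⁆ x))

  ∈-replace⁺ : ∀ {z} → z ∈ e → z ≢ b → z ∈ replace e b x
  ∈-replace⁺ z∈e z≢b = x∈p∪q⁺ (inj₁ (x∈p∧x≢y⇒x∈p-y z∈e z≢b))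

  ∈-replace⁻ : ∀ {z} → z ∈ replace e b x → z ≡ x ⊎ (z ∈ e × z ≢ b)
  ∈-replace⁻ z∈r with x∈p∪q⁻ (e - b) ⁅ x ⁆ z∈r
  ... | inj₁ z∈e-b = inj₂ (x∈p-y⁻ e z∈e-b)
  ... | inj₂ z∈⁅x⁆ = inj₁ (x∈⁅y⁆⇒x≡y x z∈⁅x⁆)

  b∉replace : b ≢ x → b ∉ replace e b x
  b∉replace b≢x b∈r with ∈-replace⁻ b∈r
  ... | inj₁ b≡x       = b≢x b≡x
  ... | inj₂ (_ , b≢b) = b≢b refl

exchange : ∀ {m} {C e f : Subset n} → ∣ C ∣ ≡ m → ∣ e ∣ ≡ suc m → ∣ f ∣ ≡ suc m
  → C ⊆ e → C ⊆ f → f ≢ e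
  → ∃ λ b → ∃ λ x → b ∈ e × x ∉ e × C ≡ e - b × f ≡ replace e b x
exchange {m = m} {C} {e} {f} ∣C∣ ∣e∣ ∣f∣ C⊆e C⊆f f≢e with ⊆-or-witness e f | ⊆-or-witness f e
... | inj₁ e⊆f | _         = ⊥-elim (f≢e (sym (⊆∧∣∣≡⇒≡ e⊆f (trans ∣e∣ (sym ∣f∣)))))
... | inj₂ _   | inj₁ f⊆e = ⊥-elim (f≢e (⊆∧∣∣≡⇒≡ f⊆e (trans ∣f∣ (sym ∣e∣))))
... | inj₂ (b , b∈e , b∉f) | inj₂ (x , x∈f , x∉e) = b , x , b∈e , x∉e , C≡e-b , f≡replace
  where
  ∣e-b∣ : ∣ e - b ∣ ≡ m
  ∣e-b∣ = suc-injective (trans (∣p-x∣+1≡∣p∣ e b∈e) ∣e∣)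

  C⊆e-b : C ⊆ e - b
  C⊆e-b z∈C = x∈p∧x≢y⇒x∈p-y (C⊆e z∈C) (λ { refl → b∉f (C⊆f z∈C) })

  C≡e-b : C ≡ e - b
  C≡e-b = ⊆∧∣∣≡⇒≡ C⊆e-b (trans ∣C∣ (sym ∣e-b∣))

  replace⊆f : replace e b x ⊆ f
  replace⊆f z∈r with ∈-replace⁻ z∈r
  ... | inj₁ refl          = x∈f
  ... | inj₂ (z∈e , z≢b) = C⊆f (subst (_ ∈_) (sym C≡e-b) (x∈p∧x≢y⇒x∈p-y z∈e z≢b))

  ∣replace∣ : ∣ replace e b x ∣ ≡ suc m
  ∣replace∣ = trans (∣p∪⁅x⁆∣≡∣p∣+1 (e - b) (x∉e ∘ proj₁ ∘ x∈p-y⁻ e)) (cong suc ∣e-b∣)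

  f≡replace : f ≡ replace e b x
  f≡replace = sym (⊆∧∣∣≡⇒≡ replace⊆f (trans ∣replace∣ (sym ∣f∣)))

window-seq-short : ∀ {k l} {E : EdgeSet n} {v : ℕ → Fin n}
  → TwoHypertree k E → IsWindowSeq k E l v → seqLength k l ≤ 2
window-seq-short {l = l} {v = v} ((_ , semicycle-free) , chains-short) ws with v 0 Fin.≟ v (l ∸ 1)
... | yes ends-equal  = ⊥-elim (semicycle-free l v (ws , ends-equal))
... | no  ends-differ = chains-short l v (ws , ends-differ)

three-window-seq : ∀ {k} {E : EdgeSet n} {v : ℕ → Fin n} → Uniform k E
  → E (window k v 0) → E (window k v 1) → E (window k v 2)
  → window k v 0 ≢ window k v 1 → window k v 0 ≢ window k v 2 → window k v 1 ≢ window k v 2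
  → IsWindowSeq k E (2 + k) v
three-window-seq {k = k} {E} {v} uniform E₀ E₁ E₂ W₀≢W₁ W₀≢W₂ W₁≢W₂ =
  m≤n+m k 2 , sizes , distinct , edges
  where
  W : ℕ → Subset _
  W = window k v

  past-end : ∀ i → ¬ (3 + i + k ≤ 2 + k)
  past-end i (s≤s (s≤s i+k<k)) = 1+n≰n (≤-trans (s≤s (m≤n+m k i)) i+k<k)

  edges : ∀ i → i + k ≤ 2 + k → E (W i)
  edges 0 _ = E₀
  edges 1 _ = E₁
  edges 2 _ = E₂
  edges (suc (suc (suc i))) i+k≤ = ⊥-elim (past-end i i+k≤)

  sizes : ∀ i → i + k ≤ 2 + k → ∣ W i ∣ ≡ k
  sizes i i+k≤ = uniform (W i) (edges i i+k≤)

  distinct : ∀ i j → i + k ≤ 2 + k → j + k ≤ 2 + k → i ≢ j → W i ≢ W j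
  distinct (suc (suc (suc i))) _ i+k≤ _ _ = ⊥-elim (past-end i i+k≤)
  distinct _ (suc (suc (suc j))) _ j+k≤ _ = ⊥-elim (past-end j j+k≤)
  distinct 0 0 _ _ i≢j = ⊥-elim (i≢j refl)
  distinct 1 1 _ _ i≢j = ⊥-elim (i≢j refl)
  distinct 2 2 _ _ i≢j = ⊥-elim (i≢j refl)
  distinct 0 1 _ _ _ = W₀≢W₁
  distinct 0 2 _ _ _ = W₀≢W₂
  distinct 1 2 _ _ _ = W₁≢W₂
  distinct 1 0 _ _ _ = W₀≢W₁ ∘ sym
  distinct 2 0 _ _ _ = W₀≢W₂ ∘ sym
  distinct 2 1 _ _ _ = W₁≢W₂ ∘ sym

no-three-windows : ∀ {k} {E : EdgeSet n} {v : ℕ → Fin n} → Uniform k E → TwoHypertree k E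
  → E (window k v 0) → E (window k v 1) → E (window k v 2)
  → window k v 0 ≢ window k v 1 → window k v 0 ≢ window k v 2 → window k v 1 ≢ window k v 2
  → ⊥
no-three-windows {k = k} {E} {v} uniform two E₀ E₁ E₂ W₀≢W₁ W₀≢W₂ W₁≢W₂ with
  subst (_≤ 2) (cong (_+ 1) (m+n∸n≡m 2 k)) (window-seq-short {E = E} {v} two (three-window-seq {E = E} {v} uniform E₀ E₁ E₂ W₀≢W₁ W₀≢W₂ W₁≢W₂))
... | s≤s (s≤s ())

-- Let e be a (m+2)-set, a ≠ b in e and
-- x, y outside e.  With D = e - a - b listed as d₁ … d_m, the sequence
--   x, a, d₁, …, d_m, b, y
-- has the three windows  replace e b x,  e,  replace e a y.
module ExchangeWalk (m : ℕ) {e : Subset n} {a b x y : Fin n}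
  (a∈e : a ∈ e) (b∈e : b ∈ e) (a≢b : a ≢ b) (∣e∣ : ∣ e ∣ ≡ 2 + m) where

  k : ℕ
  k = 2 + m

  D : Subset n
  D = e - a - b

  ∈D⁺ : ∀ {z} → z ∈ e → z ≢ a → z ≢ b → z ∈ D
  ∈D⁺ z∈e z≢a z≢b = x∈p∧x≢y⇒x∈p-y (x∈p∧x≢y⇒x∈p-y z∈e z≢a) z≢b

  ∈D⁻ : ∀ {z} → z ∈ D → z ∈ e × z ≢ a × z ≢ b
  ∈D⁻ z∈D = let z∈e-a , z≢b = x∈p-y⁻ (e - a) z∈D ; z∈e , z≢a = x∈p-y⁻ e z∈e-a in z∈e , z≢a , z≢b

  ∣D∣ : ∣ D ∣ ≡ m
  ∣D∣ = suc-injective (suc-injective (begin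
    suc (suc ∣ D ∣)  ≡⟨ cong suc (∣p-x∣+1≡∣p∣ (e - a) (x∈p∧x≢y⇒x∈p-y b∈e (a≢b ∘ sym))) ⟩
    suc ∣ e - a ∣    ≡⟨ ∣p-x∣+1≡∣p∣ e a∈e ⟩
    ∣ e ∣            ≡⟨ ∣e∣ ⟩
    2 + m            ∎))
    where open ≡-Reasoning

  L : List (Fin n)
  L = proj₁ (listing D)

  ∣L∣ : length L ≡ m
  ∣L∣ = trans (proj₁ (proj₂ (listing D))) ∣D∣

  ends : ℕ → Fin n
  ends zero    = b
  ends (suc _) = y

  v : ℕ → Fin n
  v = prepend (x ∷ a ∷ L) ends

  v-D : ∀ {t} → t < m → v (2 + t) ∈ D
  v-D t<m = proj₂ (proj₂ (proj₂ (listing D))) (prepend-∈ ends L (subst (_ <_) (sym ∣L∣) t<m))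

  D-index : ∀ {z} → z ∈ D → ∃ λ t → t < m × v (2 + t) ≡ z
  D-index z∈D with prepend-index ends L (proj₁ (proj₂ (proj₂ (listing D))) z∈D)
  ... | t , t<L , eq = t , subst (t <_) ∣L∣ t<L , eq

  v-end : ∀ j → v (2 + (m + j)) ≡ ends j
  v-end j = subst (λ l → prepend L ends (l + j) ≡ ends j) ∣L∣ (prepend-after ends L j)

  v-b : v (2 + m) ≡ b
  v-b = subst (λ t → v (2 + t) ≡ b) (+-identityʳ m) (v-end 0)

  v-y : v (3 + m) ≡ y
  v-y = subst (λ t → v (2 + t) ≡ y) (+-comm m 1) (v-end 1)

  window₀ : window k v 0 ≡ replace e b x
  window₀ = window≡ k v 0 sound complete
    where
    sound : ∀ j → j < k → v j ∈ replace e b x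
    sound 0 _ = x∈replace
    sound 1 _ = ∈-replace⁺ a∈e a≢b
    sound (suc (suc t)) (s≤s (s≤s t<m)) = let z∈e , _ , z≢b = ∈D⁻ (v-D t<m) in ∈-replace⁺ z∈e z≢b

    complete : ∀ {z} → z ∈ replace e b x → ∃ λ j → j < k × v j ≡ z
    complete {z} z∈r with ∈-replace⁻ z∈r
    ... | inj₁ refl = 0 , s≤s z≤n , refl
    ... | inj₂ (z∈e , z≢b) with z Fin.≟ a
    ...   | yes refl = 1 , s≤s (s≤s z≤n) , refl
    ...   | no  z≢a  = let t , t<m , eq = D-index (∈D⁺ z∈e z≢a z≢b) in 2 + t , s≤s (s≤s t<m) , eq

  window₁ : window k v 1 ≡ e
  window₁ = window≡ k v 1 sound complete
    where
    sound : ∀ j → j < k → v (1 + j) ∈ e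
    sound zero _ = a∈e
    sound (suc t) (s≤s t<1+m) with m<1+n⇒m<n∨m≡n t<1+m
    ... | inj₁ t<m  = proj₁ (∈D⁻ (v-D t<m))
    ... | inj₂ refl = subst (_∈ e) (sym v-b) b∈e

    complete : ∀ {z} → z ∈ e → ∃ λ j → j < k × v (1 + j) ≡ z
    complete {z} z∈e with z Fin.≟ a | z Fin.≟ b
    ... | yes refl | _        = 0 , s≤s z≤n , refl
    ... | no  _    | yes refl = suc m , ≤-refl , v-b
    ... | no  z≢a  | no  z≢b  = let t , t<m , eq = D-index (∈D⁺ z∈e z≢a z≢b) in suc t , s≤s (m<n⇒m<1+n t<m) , eq

  window₂ : window k v 2 ≡ replace e a y
  window₂ = window≡ k v 2 sound complete
    where
    sound : ∀ j → j < k → v (2 + j) ∈ replace e a y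
    sound j j<2+m with m<1+n⇒m<n∨m≡n j<2+m
    ... | inj₂ refl = subst (_∈ replace e a y) (sym v-y) x∈replace
    ... | inj₁ j<1+m with m<1+n⇒m<n∨m≡n j<1+m
    ...   | inj₂ refl = subst (_∈ replace e a y) (sym v-b) (∈-replace⁺ b∈e (a≢b ∘ sym))
    ...   | inj₁ j<m  = let z∈e , z≢a , _ = ∈D⁻ (v-D j<m) in ∈-replace⁺ z∈e z≢a

    complete : ∀ {z} → z ∈ replace e a y → ∃ λ j → j < k × v (2 + j) ≡ z
    complete {z} z∈r with ∈-replace⁻ z∈r
    ... | inj₁ refl = suc m , ≤-refl , v-y
    ... | inj₂ (z∈e , z≢a) with z Fin.≟ b
    ...   | yes refl = m , m<n⇒m<1+n ≤-refl , v-b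
    ...   | no  z≢b  = let t , t<m , eq = D-index (∈D⁺ z∈e z≢a z≢b) in t , m<n⇒m<1+n (m<n⇒m<1+n t<m) , eq

exchange-walk-impossible : ∀ m {E : EdgeSet n} {e : Subset n} {a b x y : Fin n}
  → Uniform (2 + m) E → TwoHypertree (2 + m) E
  → E e → E (replace e b x) → E (replace e a y)
  → a ∈ e → b ∈ e → a ≢ b → x ∉ e → y ∉ e → ⊥
exchange-walk-impossible m {E} {e} uniform two Ee Ef Eg a∈e b∈e a≢b x∉e y∉e =
  no-three-windows {v = v} uniform two
    (subst E (sym window₀) Ef) (subst E (sym window₁) Ee) (subst E (sym window₂) Eg)
    (windows-apart 1 0 window₁ window₀ b∈e (b∉replace (λ { refl → x∉e b∈e })) ∘ sym)
    (windows-apart 0 2 window₀ window₂ (∈-replace⁺ a∈e a≢b) (b∉replace (λ { refl → y∉e a∈e })))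
    (windows-apart 1 2 window₁ window₂ a∈e (b∉replace (λ { refl → y∉e a∈e })))
  where
  open ExchangeWalk m a∈e b∈e a≢b (uniform e Ee)

  windows-apart : ∀ i j {p q : Subset _} {z} → window k v i ≡ p → window k v j ≡ q
    → z ∈ p → z ∉ q → window k v i ≢ window k v j
  windows-apart _ _ refl refl z∈p z∉q Wᵢ≡Wⱼ = z∉q (subst (_ ∈_) Wᵢ≡Wⱼ z∈p)

EdgesThrough : EdgeSet n → Subset n → EdgeSet n
EdgesThrough E C h = E h × C ⊆ h

module _ (k : ℕ) {E : EdgeSet n} {S : EdgeSet n} (S-maximal : MaximalStar k E S) where

  maximal-star-⊆ : ∀ {T} → Star k E T → S ⊆ₚ T → S ≐ T
  maximal-star-⊆ T-star S⊆T = S⊆T , proj₂ S-maximal _ T-star S⊆T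

  maximal-star-full : ∀ {C} → ∣ C ∣ ≡ k ∸ 1 → (∀ h → S h → C ⊆ h) → EdgesThrough E C ⊆ₚ S
  maximal-star-full {C} ∣C∣ C⊆S = proj₂ S-maximal (EdgesThrough E C) through-star S⊆through
    where
    S⊆E : S ⊆ₚ E
    S⊆E = proj₁ (proj₁ S-maximal)
    S⊆through : S ⊆ₚ EdgesThrough E C
    S⊆through {h} Sh = S⊆E Sh , C⊆S h Sh
    through-star : Star k E (EdgesThrough E C)
    through-star = let h , Sh = proj₁ (proj₂ (proj₁ S-maximal)) in
      proj₁ , (h , S⊆through Sh) , C , ∣C∣ , λ _ → proj₂

common-centre : ∀ k {E S T : EdgeSet n} {C} → MaximalStar k E S → MaximalStar k E T
  → ∣ C ∣ ≡ k ∸ 1 → (∀ h → S h → C ⊆ h) → (∀ h → T h → C ⊆ h) → S ≐ T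
common-centre k S-maximal T-maximal ∣C∣ C⊆S C⊆T =
  maximal-star-⊆ k S-maximal (proj₁ T-maximal)
    λ {h} Sh → maximal-star-full k T-maximal ∣C∣ C⊆T (proj₁ (proj₁ S-maximal) Sh , C⊆S h Sh)

-- A maximal star sharing the edge e with a different star has an edge other
-- than e (otherwise it would lie inside that star).
beyond-shared-edge : ∀ k {E S T : EdgeSet n} {e} → MaximalStar k E S → Star k E T
  → ¬ (S ≐ T) → T e → ¬ (∀ h → S h → h ≡ e)
beyond-shared-edge k {T = T} S-maximal T-star S≉T Te only-e =
  S≉T (maximal-star-⊆ k S-maximal T-star λ {h} Sh → subst T (sym (only-e h Sh)) Te)

lemma3 : (k n : ℕ) → 2 ≤ k → (E : EdgeSet n) → Uniform k E → TwoHypertree k E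
    → (S T : EdgeSet n) → MaximalStar k E S → MaximalStar k E T → ¬ (S ≐ T)
    → (e : Subset n) → S e → T e → ⊥
lemma3 k@(suc (suc m)) n (s≤s (s≤s z≤n)) E uniform two S T
  S-maximal@((S⊆E , _ , Cₛ , ∣Cₛ∣ , Cₛ⊆S) , _) T-maximal@((T⊆E , _ , Cₜ , ∣Cₜ∣ , Cₜ⊆T) , _) S≉T e Se Te =
  beyond-shared-edge k S-maximal (proj₁ T-maximal) S≉T Te λ f Sf → decidable-stable (f ≟ₛ e) λ f≢e →
  beyond-shared-edge k T-maximal (proj₁ S-maximal) (S≉T ∘ ≐-sym) Se λ g Tg → decidable-stable (g ≟ₛ e) λ g≢e →
  exchanges-clash f Sf f≢e g Tg g≢e
  where
  ∣e∣ : ∣ e ∣ ≡ k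
  ∣e∣ = uniform e (S⊆E Se)

  exchanges-clash : ∀ f → S f → f ≢ e → ∀ g → T g → g ≢ e → ⊥
  exchanges-clash f Sf f≢e g Tg g≢e
    with exchange ∣Cₛ∣ ∣e∣ (uniform f (S⊆E Sf)) (Cₛ⊆S e Se) (Cₛ⊆S f Sf) f≢e
       | exchange ∣Cₜ∣ ∣e∣ (uniform g (T⊆E Tg)) (Cₜ⊆T e Te) (Cₜ⊆T g Tg) g≢e
  ... | b , x , b∈e , x∉e , Cₛ≡e-b , f≡e-b+x | a , y , a∈e , y∉e , Cₜ≡e-a , g≡e-a+y =
    exchange-walk-impossible m uniform two
      (S⊆E Se) (subst E f≡e-b+x (S⊆E Sf)) (subst E g≡e-a+y (T⊆E Tg)) a∈e b∈e a≢b x∉e y∉e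
    where
    a≢b : a ≢ b
    a≢b refl = S≉T (common-centre k S-maximal T-maximal ∣Cₛ∣ Cₛ⊆S
      λ h Th → subst (_⊆ h) (trans Cₜ≡e-a (sym Cₛ≡e-b)) (Cₜ⊆T h Th))
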